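{- In a dagger category $(\mathbb{X},\dagger)$ with unique Moore-Penrose square roots, Moore-Penrose polar decompositions are unique: if $(u,h)$ and $(v,k)$ are both Moore-Penrose polar decompositions of a map $f: A\to B$, then $u = v$ and $h = k$.
   Context: Composition is in diagrammatic order. A dagger category is a category with an identity-on-objects contravariant involutive functor $\dagger$. A partial isometry is $q$ with $qq^\dagger q = q$; $p: A\to A$ is positive if $p = gg^\dagger$ for some $g$. A Moore-Penrose inverse of $f: A\to B$ is $f^\circ: B\to A$ with $ff^\circ f = f$, $f^\circ f f^\circ = f^\circ$, $(ff^\circ)^\dagger = ff^\circ$, $(f^\circ f)^\dagger = f^\circ f$. A Moore-Penrose invertible positive map $p$ has a Moore-Penrose square root if there is a Moore-Penrose invertible positive map $\sqrt{p}$ with $\sqrt{p}\sqrt{p} = p$; the dagger category has unique Moore-Penrose square roots if every Moore-Penrose invertible positive map has exactly one such square root. A Moore-Penrose polar decomposition of $f: A\to B$ is a pair $(u: A\to B, h: B\to B)$ with $u$ a partial isometry, $h$ positive and Moore-Penrose invertible, $f = uh$, and $u^\dagger u = hh^\circ$. -}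

module Defs where

open import Level using (Level; _⊔_) renaming (suc to lsuc)
open import Data.Product using (Σ; ∃; _×_; _,_)
open import Relation.Binary.PropositionalEquality using (_≡_)

-- A category whose composition is written in diagrammatic order:
-- for f : A ⇒ B and g : B ⇒ C, f ⨾ g : A ⇒ C ("first f, then g").
record DaggerCategory (o ℓ : Level) : Set (lsuc (o ⊔ ℓ)) where
  infixl 9 _⨾_
  infix 10 _†
  field
    Obj  : Set o
    _⇒_  : Obj → Obj → Set ℓ
    id   : ∀ {A} → A ⇒ A
    _⨾_  : ∀ {A B C} → A ⇒ B → B ⇒ C → A ⇒ C
    identityˡ : ∀ {A B} (f : A ⇒ B) → id ⨾ f ≡ f
    identityʳ : ∀ {A B} (f : A ⇒ B) → f ⨾ id ≡ f
    assoc : ∀ {A B C D} (f : A ⇒ B) (g : B ⇒ C) (h : C ⇒ D) →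
            (f ⨾ g) ⨾ h ≡ f ⨾ (g ⨾ h)
    _†   : ∀ {A B} → A ⇒ B → B ⇒ A
    †-identity : ∀ {A} → (id {A}) † ≡ id
    †-homomorphism : ∀ {A B C} (f : A ⇒ B) (g : B ⇒ C) → (f ⨾ g) † ≡ g † ⨾ f †
    †-involutive : ∀ {A B} (f : A ⇒ B) → (f †) † ≡ f

module DaggerNotions {o ℓ : Level} (𝕏 : DaggerCategory o ℓ) where
  open DaggerCategory 𝕏

  IsPartialIsometry : ∀ {A B} → A ⇒ B → Set ℓ
  IsPartialIsometry q = q ⨾ q † ⨾ q ≡ q

  IsPositive : ∀ {A} → A ⇒ A → Set (o ⊔ ℓ)
  IsPositive {A} p = Σ Obj λ C → Σ (A ⇒ C) λ g → p ≡ g ⨾ g †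

  record IsMPInverse {A B} (f : A ⇒ B) (f° : B ⇒ A) : Set ℓ where
    field
      mp₁ : f ⨾ f° ⨾ f ≡ f
      mp₂ : f° ⨾ f ⨾ f° ≡ f°
      mp₃ : (f ⨾ f°) † ≡ f ⨾ f°
      mp₄ : (f° ⨾ f) † ≡ f° ⨾ f

  MPInvertible : ∀ {A B} → A ⇒ B → Set ℓ
  MPInvertible {A} {B} f = Σ (B ⇒ A) λ f° → IsMPInverse f f°

  IsMPSquareRoot : ∀ {A} → A ⇒ A → A ⇒ A → Set (o ⊔ ℓ)
  IsMPSquareRoot p s = IsPositive s × MPInvertible s × (s ⨾ s ≡ p)

  HasUniqueMPSquareRoots : Set (o ⊔ ℓ)
  HasUniqueMPSquareRoots =
    ∀ {A} (p : A ⇒ A) → IsPositive p → MPInvertible p →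
    Σ (A ⇒ A) λ s → IsMPSquareRoot p s × (∀ s′ → IsMPSquareRoot p s′ → s′ ≡ s)

  -- (u , h) is a Moore-Penrose polar decomposition of f : A → B.
  -- h° is a Moore-Penrose inverse of h (these are unique when they exist).
  record IsMPPolarDecomposition {A B} (f : A ⇒ B) (u : A ⇒ B) (h : B ⇒ B) : Set (o ⊔ ℓ) where
    field
      u-partialIsometry : IsPartialIsometry u
      h-positive        : IsPositive h
      h°                : B ⇒ B
      h°-MPInverse      : IsMPInverse h h°
      factorisation     : f ≡ u ⨾ h
      support           : u † ⨾ u ≡ h ⨾ h°

-- Both h and k are Moore-Penrose square roots of f † ⨾ f: since h is self-adjoint and
-- u † ⨾ u = h ⨾ h°, we get f † ⨾ f = h ⨾ (h ⨾ h° ⨾ h) = h ⨾ h.  Uniqueness of square roots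
-- gives h = k.  The partial isometry is then recovered as u = u ⨾ u † ⨾ u = u ⨾ h ⨾ h° = f ⨾ h°,
-- and Moore-Penrose inverses are unique, so u = v.
{-# OPTIONS --safe #-}
module Submission where

open import Defs
open import Level using (Level)
open import Data.Product using (_×_; _,_)
open import Relation.Binary.PropositionalEquality
  using (_≡_; sym; trans; cong; cong₂; subst; module ≡-Reasoning)

module DaggerProperties {o ℓ : Level} (𝕏 : DaggerCategory o ℓ) where
  open DaggerCategory 𝕏
  open DaggerNotions 𝕏
  open ≡-Reasoning

  IsSelfAdjoint : ∀ {A} → A ⇒ A → Set ℓ
  IsSelfAdjoint h = h † ≡ h

  †-homomorphism₃ : ∀ {A B C D} (a : A ⇒ B) (b : B ⇒ C) (c : C ⇒ D) →
                    (a ⨾ b ⨾ c) † ≡ c † ⨾ b † ⨾ a †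
  †-homomorphism₃ a b c = begin
    (a ⨾ b ⨾ c) †     ≡⟨ †-homomorphism (a ⨾ b) c ⟩
    c † ⨾ (a ⨾ b) †   ≡⟨ cong (c † ⨾_) (†-homomorphism a b) ⟩
    c † ⨾ (b † ⨾ a †) ≡⟨ assoc _ _ _ ⟨
    c † ⨾ b † ⨾ a †   ∎

  positive⇒selfAdjoint : ∀ {A} {h : A ⇒ A} → IsPositive h → IsSelfAdjoint h
  positive⇒selfAdjoint {h = h} (_ , g , h≡gg†) = begin
    h †           ≡⟨ cong _† h≡gg† ⟩
    (g ⨾ g †) †   ≡⟨ †-homomorphism g (g †) ⟩
    g † † ⨾ g †   ≡⟨ cong (_⨾ g †) (†-involutive g) ⟩
    g ⨾ g †       ≡⟨ h≡gg† ⟨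
    h             ∎

  selfAdjoint⇒square-positive : ∀ {A} {h : A ⇒ A} → IsSelfAdjoint h → IsPositive (h ⨾ h)
  selfAdjoint⇒square-positive {h = h} h†≡h = _ , h , cong (h ⨾_) (sym h†≡h)

  module _ {A B} {f : A ⇒ B} {x y : B ⇒ A} (X : IsMPInverse f x) (Y : IsMPInverse f y) where
    private
      module X = IsMPInverse X
      module Y = IsMPInverse Y

    IsMPInverse-rangeProjection-unique : f ⨾ x ≡ f ⨾ y
    IsMPInverse-rangeProjection-unique = begin
      f ⨾ x                       ≡⟨ X.mp₃ ⟨
      (f ⨾ x) †                   ≡⟨ †-homomorphism f x ⟩
      x † ⨾ f †                   ≡⟨ cong (λ z → x † ⨾ z †) Y.mp₁ ⟨
      x † ⨾ (f ⨾ y ⨾ f) †         ≡⟨ cong (x † ⨾_) (†-homomorphism (f ⨾ y) f) ⟩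
      x † ⨾ (f † ⨾ (f ⨾ y) †)     ≡⟨ assoc _ _ _ ⟨
      x † ⨾ f † ⨾ (f ⨾ y) †       ≡⟨ cong (_⨾ (f ⨾ y) †) (†-homomorphism f x) ⟨
      (f ⨾ x) † ⨾ (f ⨾ y) †       ≡⟨ cong₂ _⨾_ X.mp₃ Y.mp₃ ⟩
      (f ⨾ x) ⨾ (f ⨾ y)           ≡⟨ assoc _ _ _ ⟨
      f ⨾ x ⨾ f ⨾ y               ≡⟨ cong (_⨾ y) X.mp₁ ⟩
      f ⨾ y                       ∎

    IsMPInverse-domainProjection-unique : x ⨾ f ≡ y ⨾ f
    IsMPInverse-domainProjection-unique = begin
      x ⨾ f                       ≡⟨ X.mp₄ ⟨
      (x ⨾ f) †                   ≡⟨ †-homomorphism x f ⟩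
      f † ⨾ x †                   ≡⟨ cong (λ z → z † ⨾ x †) (trans (sym Y.mp₁) (assoc _ _ _)) ⟩
      (f ⨾ (y ⨾ f)) † ⨾ x †       ≡⟨ cong (_⨾ x †) (†-homomorphism f (y ⨾ f)) ⟩
      (y ⨾ f) † ⨾ f † ⨾ x †       ≡⟨ assoc _ _ _ ⟩
      (y ⨾ f) † ⨾ (f † ⨾ x †)     ≡⟨ cong ((y ⨾ f) † ⨾_) (†-homomorphism x f) ⟨
      (y ⨾ f) † ⨾ (x ⨾ f) †       ≡⟨ cong₂ _⨾_ Y.mp₄ X.mp₄ ⟩
      (y ⨾ f) ⨾ (x ⨾ f)           ≡⟨ assoc _ _ _ ⟩
      y ⨾ (f ⨾ (x ⨾ f))           ≡⟨ cong (y ⨾_) (trans (sym (assoc _ _ _)) X.mp₁) ⟩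
      y ⨾ f                       ∎

    IsMPInverse-unique : x ≡ y
    IsMPInverse-unique = begin
      x                 ≡⟨ X.mp₂ ⟨
      x ⨾ f ⨾ x         ≡⟨ cong (_⨾ x) IsMPInverse-domainProjection-unique ⟩
      y ⨾ f ⨾ x         ≡⟨ assoc _ _ _ ⟩
      y ⨾ (f ⨾ x)       ≡⟨ cong (y ⨾_) IsMPInverse-rangeProjection-unique ⟩
      y ⨾ (f ⨾ y)       ≡⟨ assoc _ _ _ ⟨
      y ⨾ f ⨾ y         ≡⟨ Y.mp₂ ⟩
      y                 ∎

  IsMPInverse-† : ∀ {A B} {f : A ⇒ B} {f° : B ⇒ A} → IsMPInverse f f° → IsMPInverse (f †) (f° †)
  IsMPInverse-† {f = f} {f°} M = record
    { mp₁ = trans (sym (†-homomorphism₃ f f° f)) (cong _† mp₁)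
    ; mp₂ = trans (sym (†-homomorphism₃ f° f f°)) (cong _† mp₂)
    ; mp₃ = begin
        (f † ⨾ f° †) †      ≡⟨ †-homomorphism (f †) (f° †) ⟩
        f° † † ⨾ f † †      ≡⟨ cong₂ _⨾_ (†-involutive f°) (†-involutive f) ⟩
        f° ⨾ f              ≡⟨ mp₄ ⟨
        (f° ⨾ f) †          ≡⟨ †-homomorphism f° f ⟩
        f † ⨾ f° †          ∎
    ; mp₄ = begin
        (f° † ⨾ f †) †      ≡⟨ †-homomorphism (f° †) (f †) ⟩
        f † † ⨾ f° † †      ≡⟨ cong₂ _⨾_ (†-involutive f) (†-involutive f°) ⟩
        f ⨾ f°              ≡⟨ mp₃ ⟨
        (f ⨾ f°) †          ≡⟨ †-homomorphism f f° ⟩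
        f° † ⨾ f †          ∎
    }
    where open IsMPInverse M

  module _ {A} {h h° : A ⇒ A} (h†≡h : IsSelfAdjoint h) (M : IsMPInverse h h°) where
    open IsMPInverse M

    IsMPInverse-selfAdjoint : IsSelfAdjoint h°
    IsMPInverse-selfAdjoint =
      IsMPInverse-unique (subst (λ z → IsMPInverse z (h° †)) h†≡h (IsMPInverse-† M)) M

    IsMPInverse-selfAdjoint-comm : h ⨾ h° ≡ h° ⨾ h
    IsMPInverse-selfAdjoint-comm = begin
      h ⨾ h°          ≡⟨ mp₃ ⟨
      (h ⨾ h°) †      ≡⟨ †-homomorphism h h° ⟩
      h° † ⨾ h †      ≡⟨ cong₂ _⨾_ IsMPInverse-selfAdjoint h†≡h ⟩
      h° ⨾ h          ∎

    private
      rangeProjection-square : (h ⨾ h) ⨾ (h° ⨾ h°) ≡ h ⨾ h°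
      rangeProjection-square = begin
        (h ⨾ h) ⨾ (h° ⨾ h°)   ≡⟨ assoc _ _ _ ⟩
        h ⨾ (h ⨾ (h° ⨾ h°))   ≡⟨ cong (h ⨾_) (sym (assoc _ _ _)) ⟩
        h ⨾ (h ⨾ h° ⨾ h°)     ≡⟨ cong (λ z → h ⨾ (z ⨾ h°)) IsMPInverse-selfAdjoint-comm ⟩
        h ⨾ (h° ⨾ h ⨾ h°)     ≡⟨ cong (h ⨾_) mp₂ ⟩
        h ⨾ h°                ∎

      domainProjection-square : (h° ⨾ h°) ⨾ (h ⨾ h) ≡ h° ⨾ h
      domainProjection-square = begin
        (h° ⨾ h°) ⨾ (h ⨾ h)   ≡⟨ assoc _ _ _ ⟩
        h° ⨾ (h° ⨾ (h ⨾ h))   ≡⟨ cong (h° ⨾_) (sym (assoc _ _ _)) ⟩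
        h° ⨾ (h° ⨾ h ⨾ h)     ≡⟨ cong (λ z → h° ⨾ (z ⨾ h)) IsMPInverse-selfAdjoint-comm ⟨
        h° ⨾ (h ⨾ h° ⨾ h)     ≡⟨ cong (h° ⨾_) mp₁ ⟩
        h° ⨾ h                ∎

    IsMPInverse-selfAdjoint-square : IsMPInverse (h ⨾ h) (h° ⨾ h°)
    IsMPInverse-selfAdjoint-square = record
      { mp₁ = trans (cong (_⨾ (h ⨾ h)) rangeProjection-square)
                    (trans (sym (assoc _ _ _)) (cong (_⨾ h) mp₁))
      ; mp₂ = trans (cong (_⨾ (h° ⨾ h°)) domainProjection-square)
                    (trans (sym (assoc _ _ _)) (cong (_⨾ h°) mp₂))
      ; mp₃ = trans (cong _† rangeProjection-square) (trans mp₃ (sym rangeProjection-square))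
      ; mp₄ = trans (cong _† domainProjection-square) (trans mp₄ (sym domainProjection-square))
      }

  MPSquareRoot-unique : HasUniqueMPSquareRoots →
    ∀ {A} {p s t : A ⇒ A} → IsMPSquareRoot p s → IsMPSquareRoot p t → s ≡ t
  MPSquareRoot-unique uniqueRoots {p = p} {s} {t} S@(s-positive , (s° , s°-MPInverse) , ss≡p) T
    with uniqueRoots p p-positive (s° ⨾ s° , p-MPInverse)
    where
    s†≡s : IsSelfAdjoint s
    s†≡s = positive⇒selfAdjoint s-positive

    p-positive : IsPositive p
    p-positive = subst IsPositive ss≡p (selfAdjoint⇒square-positive s†≡s)

    p-MPInverse : IsMPInverse p (s° ⨾ s°)
    p-MPInverse = subst (λ z → IsMPInverse z (s° ⨾ s°)) ss≡p
                        (IsMPInverse-selfAdjoint-square s†≡s s°-MPInverse)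
  ... | _ , _ , isUnique = trans (isUnique s S) (sym (isUnique t T))

  module _ {A B} {f u : A ⇒ B} {h : B ⇒ B} (P : IsMPPolarDecomposition f u h) where
    open IsMPPolarDecomposition P
    open IsMPInverse h°-MPInverse

    polarDecomposition-square : f † ⨾ f ≡ h ⨾ h
    polarDecomposition-square = begin
      f † ⨾ f                  ≡⟨ cong₂ (λ a b → a † ⨾ b) factorisation factorisation ⟩
      (u ⨾ h) † ⨾ (u ⨾ h)      ≡⟨ cong (_⨾ (u ⨾ h)) (†-homomorphism u h) ⟩
      h † ⨾ u † ⨾ (u ⨾ h)      ≡⟨ cong (λ z → z ⨾ u † ⨾ (u ⨾ h)) (positive⇒selfAdjoint h-positive) ⟩
      h ⨾ u † ⨾ (u ⨾ h)        ≡⟨ assoc _ _ _ ⟩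
      h ⨾ (u † ⨾ (u ⨾ h))      ≡⟨ cong (h ⨾_) (sym (assoc _ _ _)) ⟩
      h ⨾ (u † ⨾ u ⨾ h)        ≡⟨ cong (λ z → h ⨾ (z ⨾ h)) support ⟩
      h ⨾ (h ⨾ h° ⨾ h)         ≡⟨ cong (h ⨾_) mp₁ ⟩
      h ⨾ h                    ∎

    polarDecomposition-MPSquareRoot : IsMPSquareRoot (f † ⨾ f) h
    polarDecomposition-MPSquareRoot =
      h-positive , (h° , h°-MPInverse) , sym polarDecomposition-square

    polarDecomposition-partialIsometry : u ≡ f ⨾ h°
    polarDecomposition-partialIsometry = begin
      u                ≡⟨ u-partialIsometry ⟨
      u ⨾ u † ⨾ u      ≡⟨ assoc _ _ _ ⟩
      u ⨾ (u † ⨾ u)    ≡⟨ cong (u ⨾_) support ⟩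
      u ⨾ (h ⨾ h°)     ≡⟨ assoc _ _ _ ⟨
      u ⨾ h ⨾ h°       ≡⟨ cong (_⨾ h°) factorisation ⟨
      f ⨾ h°           ∎

mainTheorem18 : {o ℓ : Level} (𝕏 : DaggerCategory o ℓ) →
    DaggerNotions.HasUniqueMPSquareRoots 𝕏 →
    ∀ {A B} (f : DaggerCategory._⇒_ 𝕏 A B)
      (u v : DaggerCategory._⇒_ 𝕏 A B) (h k : DaggerCategory._⇒_ 𝕏 B B) →
    DaggerNotions.IsMPPolarDecomposition 𝕏 f u h →
    DaggerNotions.IsMPPolarDecomposition 𝕏 f v k →
    (u ≡ v) × (h ≡ k)
mainTheorem18 𝕏 uniqueRoots f u v h k P Q = u≡v , h≡k
  where
  open DaggerCategory 𝕏
  open DaggerNotions 𝕏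
  open DaggerProperties 𝕏
  open IsMPPolarDecomposition

  h≡k : h ≡ k
  h≡k = MPSquareRoot-unique uniqueRoots
          (polarDecomposition-MPSquareRoot P) (polarDecomposition-MPSquareRoot Q)

  h°≡k° : h° P ≡ h° Q
  h°≡k° = IsMPInverse-unique (h°-MPInverse P)
            (subst (λ z → IsMPInverse z (h° Q)) (sym h≡k) (h°-MPInverse Q))

  u≡v : u ≡ v
  u≡v = trans (polarDecomposition-partialIsometry P)
              (trans (cong (f ⨾_) h°≡k°) (sym (polarDecomposition-partialIsometry Q)))
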